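{- Let $W$ be a recurrent infinite word and let $S$ be a graph with words satisfying, with respect to $W$, properties (1)–(6) of Rauzy schemes. If $u$ is a factor of $W$, then $S$ contains an admissible path $s$ such that $u$ is a factor of $F(s)$.
   Context: $u\sqsubseteq w$: $u$ is a factor of $w$; $u\sqsubseteq_k w$: $u$ occurs in $w$ at least $k$ times. $W$ is recurrent if each factor occurs infinitely often. A graph with words is a strongly connected directed multigraph each edge $e$ of which carries a front word $F(e)$ and a back word $B(e)$, and each vertex of which is either distributing (in-degree $1$, out-degree $>1$) or collecting (in-degree $>1$, out-degree $1$). A path is a sequence of consecutive edges; edge records and $s_1\sqsubseteq_k s_2$ for paths are defined via the sequences of edges as words. A path is symmetric if it starts at a collecting vertex and ends at a distributing vertex. For $s=v_1\dots v_n$: $F(s)$ is the ordered concatenation of the front words of $v_1$ and of all $v_i$ starting at a distributing vertex; $B(s)$ is the ordered concatenation of the back words of all $v_i$ ending at a collecting vertex and of $v_n$. Properties: (1) strongly connected with more than one edge; (2) front words of edges leaving a common distributing vertex have pairwise different first letters, back words of edges entering a common collecting vertex have pairwise different last letters; (3) $F(s)=B(s)$ for every symmetric path; (4) for symmetric $s_1,s_2$, $F(s_1)\sqsubseteq_kF(s_2)$ implies $s_1\sqsubseteq_k s_2$; (5) all edge words are factors of $W$; (6) every factor of $W$ is a factor of $F(s)$ for some symmetric path $s$. A symmetric path $s$ is admissible if $F(s)\sqsubseteq W$. -}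

module Defs where

open import Data.Nat using (ℕ; zero; suc; _+_; _≤_; _<_)
open import Data.Fin using (Fin)
open import Data.List using (List; []; _∷_; _++_; [_]; length; take; drop)
open import Data.Product using (Σ; ∃; ∃-syntax; _×_; _,_)
open import Data.Sum using (_⊎_)
open import Data.Unit using (⊤)
open import Relation.Binary.PropositionalEquality using (_≡_; _≢_)
open import Function.Definitions using (Injective)

module _ {X : Set} where

  OccAt : List X → List X → ℕ → Set
  OccAt u w i = (i + length u ≤ length w) × (take (length u) (drop i w) ≡ u)

  _⊑_ : List X → List X → Set
  u ⊑ w = ∃[ p ] ∃[ q ] (p ++ u ++ q ≡ w)

  _⊑[_]_ : List X → ℕ → List X → Set
  u ⊑[ k ] w = Σ (Fin k → ℕ) λ pos → Injective _≡_ _≡_ pos × (∀ j → OccAt u w (pos j))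

module _ {A : Set} where

  window : (ℕ → A) → ℕ → ℕ → List A
  window W i zero    = []
  window W i (suc n) = W i ∷ window W (suc i) n

  OccAtInf : List A → (ℕ → A) → ℕ → Set
  OccAtInf u W i = window W i (length u) ≡ u

  _⊑∞_ : List A → (ℕ → A) → Set
  u ⊑∞ W = ∃[ i ] OccAtInf u W i

  Recurrent : (ℕ → A) → Set
  Recurrent W = ∀ u → u ⊑∞ W → ∀ n → ∃[ i ] (n ≤ i × OccAtInf u W i)

data Kind : Set where
  dist coll : Kind

record GraphWithWords (A : Set) : Set₁ where
  field
    V E : Set
    src tgt : E → V
    Fw Bw : E → List A
    kind : V → Kind

  InDeg1 : V → Set
  InDeg1 v = ∃[ e ] (tgt e ≡ v × (∀ e' → tgt e' ≡ v → e' ≡ e))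

  OutDeg1 : V → Set
  OutDeg1 v = ∃[ e ] (src e ≡ v × (∀ e' → src e' ≡ v → e' ≡ e))

  InDeg>1 : V → Set
  InDeg>1 v = ∃[ e₁ ] ∃[ e₂ ] (e₁ ≢ e₂ × tgt e₁ ≡ v × tgt e₂ ≡ v)

  OutDeg>1 : V → Set
  OutDeg>1 v = ∃[ e₁ ] ∃[ e₂ ] (e₁ ≢ e₂ × src e₁ ≡ v × src e₂ ≡ v)

  Distributing : V → Set
  Distributing v = InDeg1 v × OutDeg>1 v

  Collecting : V → Set
  Collecting v = InDeg>1 v × OutDeg1 v

  field
    dist-ok : ∀ v → kind v ≡ dist → Distributing v
    coll-ok : ∀ v → kind v ≡ coll → Collecting v

  Consecutive : E → List E → Set
  Consecutive e []        = ⊤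
  Consecutive e (e' ∷ es) = (tgt e ≡ src e') × Consecutive e' es

  record Path : Set where
    eta-equality
    constructor path
    field
      first : E
      rest  : List E
      valid : Consecutive first rest

  edges : Path → List E
  edges (path e es _) = e ∷ es

  lastE : E → List E → E
  lastE e []        = e
  lastE e (e' ∷ es) = lastE e' es

  startV endV : Path → V
  startV (path e _ _)  = src e
  endV   (path e es _) = tgt (lastE e es)

  Symmetric : Path → Set
  Symmetric s = (kind (startV s) ≡ coll) × (kind (endV s) ≡ dist)

  data Reach : V → V → Set where
    here : ∀ {v} → Reach v v
    step : ∀ {v w} (e : E) → src e ≡ v → Reach (tgt e) w → Reach v w

  frontIf : E → List A
  frontIf e with kind (src e)
  ... | dist = Fw e
  ... | coll = []

  backIf : E → List A
  backIf e with kind (tgt e)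
  ... | coll = Bw e
  ... | dist = []

  Fr : List E → List A
  Fr []       = []
  Fr (e ∷ es) = frontIf e ++ Fr es

  Bk : E → List E → List A
  Bk e []        = Bw e
  Bk e (e' ∷ es) = backIf e ++ Bk e' es

  Fp : Path → List A
  Fp (path e es _) = Fw e ++ Fr es

  Bp : Path → List A
  Bp (path e es _) = Bk e es

module _ {A : Set} (W : ℕ → A) (S : GraphWithWords A) where
  open GraphWithWords S

  Prop1 : Set
  Prop1 = (∀ v w → Reach v w) × (Σ E λ e₁ → Σ E λ e₂ → e₁ ≢ e₂)

  Prop2 : Set
  Prop2 =
    (∀ e₁ e₂ → e₁ ≢ e₂ → src e₁ ≡ src e₂ → kind (src e₁) ≡ dist →
       ∃[ a ] ∃[ b ] ∃[ x ] ∃[ y ] (Fw e₁ ≡ a ∷ x × Fw e₂ ≡ b ∷ y × a ≢ b))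
    × (∀ e₁ e₂ → e₁ ≢ e₂ → tgt e₁ ≡ tgt e₂ → kind (tgt e₁) ≡ coll →
       ∃[ a ] ∃[ b ] ∃[ x ] ∃[ y ] (Bw e₁ ≡ x ++ [ a ] × Bw e₂ ≡ y ++ [ b ] × a ≢ b))

  Prop3 : Set
  Prop3 = ∀ s → Symmetric s → Fp s ≡ Bp s

  Prop4 : Set
  Prop4 = ∀ s₁ s₂ k → Symmetric s₁ → Symmetric s₂ →
          Fp s₁ ⊑[ k ] Fp s₂ → edges s₁ ⊑[ k ] edges s₂

  Prop5 : Set
  Prop5 = ∀ e → (Fw e ⊑∞ W) × (Bw e ⊑∞ W)

  Prop6 : Set
  Prop6 = ∀ u → u ⊑∞ W → ∃[ s ] (Symmetric s × u ⊑ Fp s)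

  RauzyScheme : Set
  RauzyScheme = Prop1 × Prop2 × Prop3 × Prop4 × Prop5 × Prop6

  Admissible : Path → Set
  Admissible s = Symmetric s × (Fp s ⊑∞ W)

module Submission where

-- Fix an edge t from a collecting to a distributing vertex (every symmetric path crosses one)
-- and let X = F(t). By recurrence W has a factor X g X with u a factor of the nonempty word g,
-- and by (6) X g X is a factor of F(s) for a symmetric path s. Since F(s) = B(s), the front
-- word of each edge of s leaving a collecting vertex sits at a fixed offset of F(s). Every
-- occurrence of X in F(s) is at such an offset, of a collecting-to-distributing edge as wide
-- as X: otherwise X would occur in F(s) more often than t occurs in s, against (4). The edges
-- of s from the one under the first X to the one under the second X then form a symmetric path
-- s' with F(s') = X g X, which is admissible and contains u.

open import Defs
open import Data.Nat using (ℕ; zero; suc; _+_; _≤_; _<_; s≤s; z≤n; _∸_; _≤?_; _<?_)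
open import Data.Nat.Properties
  using ( +-identityʳ; +-suc; +-monoʳ-≤; m≤m+n; m≤n+m; suc-injective; m<m+n; m+[n∸m]≡n; m<n⇒0<n∸m
        ; ≤-trans; <⇒≤; <-cmp; <⇒≢; ≤⇒≯; ≮⇒≥; ≰⇒>; 1+n≰n; anyUpTo?; _≟_)
open import Data.Fin using (Fin)
open import Data.Fin.Properties using (pigeonhole) renaming (<⇒≢ to <⇒≢ᶠ)
open import Data.List using (List; []; _∷_; _++_; [_]; length; take; drop; map; filter; upTo; lookup)
open import Data.List.Properties
  using ( ++-assoc; ++-identityʳ; length-++; length-map; ++-monoid; ++-cancelʳ; ++-conicalʳ
        ; ∷-injectiveˡ; ∷-injectiveʳ; take++drop≡id; drop-[])
open import Data.List.Membership.Propositional using (_∈_)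
open import Data.List.Membership.Propositional.Properties using (∈-filter⁺; ∈-filter⁻; ∈-upTo⁺; ∈-lookup)
open import Data.List.Relation.Unary.All using (All; []; _∷_)
import Data.List.Relation.Unary.All as All
import Data.List.Relation.Unary.All.Properties as All
open import Data.List.Relation.Unary.Any using (here; there)
import Data.List.Relation.Unary.Any as Any
open import Data.List.Relation.Unary.Any.Properties using (lookup-index)
open import Data.List.Relation.Unary.AllPairs using ([]; _∷_)
open import Data.List.Relation.Unary.Unique.Propositional using (Unique)
import Data.List.Relation.Unary.Unique.Propositional.Properties as Unique
open import Data.Product using (∃₂; ∃-syntax; _×_; _,_; proj₁; proj₂; map₁)
open import Data.Empty using (⊥; ⊥-elim)
open import Data.Unit using (tt)
open import Function using (_∘_; case_of_)
open import Function.Definitions using (Injective)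
open import Relation.Nullary using (¬_; Dec; yes; no; contradiction)
open import Relation.Nullary.Decidable using (map′; _×-dec_; ¬¬-excluded-middle)
open import Relation.Binary using (tri<; tri≈; tri>)
open import Relation.Binary.PropositionalEquality
  using (_≡_; _≢_; refl; sym; trans; cong; cong₂; subst; subst₂; module ≡-Reasoning)

module _ {X : Set} where

  lookup-injective : ∀ {xs : List X} → Unique xs → Injective _≡_ _≡_ (lookup xs)
  lookup-injective (_ ∷ _)      {Fin.zero}  {Fin.zero}  _  = refl
  lookup-injective (x∉ ∷ _)     {Fin.zero}  {Fin.suc j} eq = ⊥-elim (All.lookup x∉ (∈-lookup j) eq)
  lookup-injective (x∉ ∷ _)     {Fin.suc i} {Fin.zero}  eq = ⊥-elim (All.lookup x∉ (∈-lookup i) (sym eq))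
  lookup-injective (_ ∷ xs!)    {Fin.suc i} {Fin.suc j} eq = cong Fin.suc (lookup-injective xs! eq)

  map⁺-injectiveOn : ∀ {Y : Set} {f : X → Y} {xs} →
                     (∀ {x y} → x ∈ xs → y ∈ xs → f x ≡ f y → x ≡ y) → Unique xs → Unique (map f xs)
  map⁺-injectiveOn {xs = []}    _   []         = []
  map⁺-injectiveOn {xs = x ∷ _} inj (x∉ ∷ xs!) =
    All.map⁺ (All.tabulate λ y∈ fx≡fy → All.lookup x∉ y∈ (inj (here refl) (there y∈) fx≡fy))
    ∷ map⁺-injectiveOn (λ x∈ y∈ → inj (there x∈) (there y∈)) xs!

module _ {X : Set} where

  open import Algebra.Solver.Monoid (++-monoid X) using (solve; _⊕_; _⊜_)

  ++-cancel-length : ∀ (xs xs' : List X) {ys ys'} →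
                     length xs ≡ length xs' → xs ++ ys ≡ xs' ++ ys' → xs ≡ xs' × ys ≡ ys'
  ++-cancel-length []       []        _   eq = refl , eq
  ++-cancel-length (x ∷ xs) (x' ∷ xs') len eq =
    map₁ (cong₂ _∷_ (∷-injectiveˡ eq))
         (++-cancel-length xs xs' (suc-injective len) (∷-injectiveʳ eq))

  ⊑-++-both : ∀ {u g} (p q : List X) → u ⊑ g → u ⊑ (p ++ g ++ q)
  ⊑-++-both {u} p q (a , b , refl) =
    p ++ a , b ++ q , solve 5 (λ p a u b q → (p ⊕ a) ⊕ u ⊕ b ⊕ q ⊜ p ⊕ (a ⊕ u ⊕ b) ⊕ q) refl p a u b q

  occAt-middle : ∀ (p u q : List X) → OccAt u (p ++ u ++ q) (length p)
  occAt-middle []      u q = subst (length u ≤_) (sym (length-++ u)) (m≤m+n _ _) , take-length-++ u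
    where
    take-length-++ : ∀ xs {ys} → take (length xs) (xs ++ ys) ≡ xs
    take-length-++ []       = refl
    take-length-++ (x ∷ xs) = cong (x ∷_) (take-length-++ xs)
  occAt-middle (x ∷ p) u q = map₁ s≤s (occAt-middle p u q)

  drop-[]≢∷ : ∀ i {x : X} {xs} → drop i [] ≢ x ∷ xs
  drop-[]≢∷ i eq = case trans (sym (drop-[] i)) eq of λ ()

  drop-<⇒infix : ∀ (xs : List X) {i j y ys z zs} → i < j →
                 drop i xs ≡ y ∷ ys → drop j xs ≡ z ∷ zs → ∃[ mid ] ys ≡ mid ++ z ∷ zs
  drop-<⇒infix (x ∷ xs) {zero}  {suc j} _          refl eq  =
    take j xs , trans (sym (take++drop≡id j xs)) (cong (take j xs ++_) eq)
  drop-<⇒infix (x ∷ xs) {suc i} {suc j} (s≤s i<j) eq   eq' = drop-<⇒infix xs i<j eq eq'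
  drop-<⇒infix []       {i}             _          eq   _   = ⊥-elim (drop-[]≢∷ i eq)

  data _[_]=_ : List X → ℕ → X → Set where
    here  : ∀ {x xs} → (x ∷ xs) [ 0 ]= x
    there : ∀ {y xs i x} → xs [ i ]= x → (y ∷ xs) [ suc i ]= x

  []=? : ∀ {x xs} → All (λ y → Dec (y ≡ x)) xs → ∀ i → Dec (xs [ i ]= x)
  []=? []              i       = no λ ()
  []=? (yes refl ∷ _)  zero    = yes here
  []=? (no y≢x ∷ _)    zero    = no λ { here → y≢x refl }
  []=? (_ ∷ ds)        (suc i) = map′ there (λ { (there p) → p }) ([]=? ds i)

  []=⇒drop : ∀ {xs i x} → xs [ i ]= x → drop i xs ≡ x ∷ drop (suc i) xs
  []=⇒drop here      = refl
  []=⇒drop (there p) = []=⇒drop p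

  []=⇒< : ∀ {xs i x} → xs [ i ]= x → i < length xs
  []=⇒< here      = s≤s z≤n
  []=⇒< (there p) = s≤s ([]=⇒< p)

  []=-pred : ∀ {xs i x} → xs [ suc i ]= x → ∃₂ λ y ys → drop i xs ≡ y ∷ x ∷ ys
  []=-pred {y ∷ _} {zero}  (there here) = y , _ , refl
  []=-pred {i = suc i} (there p) = []=-pred p

  occAt-[]⇒[]= : ∀ xs i {x} → OccAt [ x ] xs i → xs [ i ]= x
  occAt-[]⇒[]= (y ∷ xs) zero    (_ , refl) = here
  occAt-[]⇒[]= (y ∷ xs) (suc i) (s≤s le , eq) = there (occAt-[]⇒[]= xs i (le , eq))

  ¬¬-decide-all : (P : X → Set) → ∀ xs → ¬ ¬ All (λ x → Dec (P x)) xs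
  ¬¬-decide-all P []       k = k []
  ¬¬-decide-all P (x ∷ xs) k = ¬¬-excluded-middle λ d → ¬¬-decide-all P xs (k ∘ (d ∷_))

  ⊑[]-unique : ∀ {u w : List X} (ps : List ℕ) → Unique ps → All (OccAt u w) ps → u ⊑[ length ps ] w
  ⊑[]-unique ps ps! occ = lookup ps , lookup-injective ps! , λ j → All.lookup occ (∈-lookup j)

  ⊑[]-≤ : ∀ {u w : List X} {k} (ps : List ℕ) → u ⊑[ k ] w →
          (∀ {i} → OccAt u w i → i ∈ ps) → k ≤ length ps
  ⊑[]-≤ {k = k} ps (pos , pos-inj , occ) mem with k ≤? length ps
  ... | yes k≤ = k≤
  ... | no  k≰ with i , j , i<j , same ← pigeonhole (≰⇒> k≰) (Any.index ∘ mem ∘ occ) =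
    contradiction (pos-inj (trans (lookup-index (mem (occ i)))
                           (trans (cong (lookup ps) same) (sym (lookup-index (mem (occ j)))))))
                  (<⇒≢ᶠ i<j)

module _ {A : Set} (W : ℕ → A) where

  open import Algebra.Solver.Monoid (++-monoid A) using (solve; _⊕_; _⊜_)

  length-window : ∀ i k → length (window W i k) ≡ k
  length-window i zero    = refl
  length-window i (suc k) = cong suc (length-window (suc i) k)

  occAtInf-window : ∀ i k → OccAtInf (window W i k) W i
  occAtInf-window i k = cong (window W i) (length-window i k)

  occAtInf-++ : ∀ {xs ys} i → OccAtInf xs W i → OccAtInf ys W (i + length xs) → OccAtInf (xs ++ ys) W i
  occAtInf-++ {[]}     {ys} i _  oy = subst (OccAtInf ys W) (+-identityʳ i) oy
  occAtInf-++ {x ∷ xs} {ys} i ox oy =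
    cong₂ _∷_ (∷-injectiveˡ ox)
              (occAtInf-++ (suc i) (∷-injectiveʳ ox) (subst (OccAtInf ys W) (+-suc i (length xs)) oy))

  -- Recurrence provides an occurrence of u after one of x, then one of x after u.
  recurrent-sandwich : Recurrent W → ∀ {x u} → x ⊑∞ W → u ⊑∞ W →
                       ∃[ g ] (0 < length g × u ⊑ g × (x ++ g ++ x) ⊑∞ W)
  recurrent-sandwich rec {x} {u} (i , ox) u⊑W
    with i₁ , a<i₁ , ou  ← rec u u⊑W (suc (i + length x))
    with i₂ , b≤i₂ , ox₂ ← rec x (i , ox) (i₁ + length u)
    = p ++ u ++ q , 0<|g| , (p , q , refl) , i , subst (λ v → OccAtInf v W i) reassoc occ
    where
    a b : ℕ
    a = i + length x
    b = i₁ + length u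

    p q : List A
    p = window W a (i₁ ∸ a)
    q = window W b (i₂ ∸ b)

    0<|g| : 0 < length (p ++ u ++ q)
    0<|g| = subst (0 <_) (sym (length-++ p))
              (≤-trans (subst (0 <_) (sym (length-window a _)) (m<n⇒0<n∸m a<i₁)) (m≤m+n _ _))

    at-end : ∀ j k {l} → j + k ≡ l → l ≡ j + length (window W j k)
    at-end j k eq = trans (sym eq) (cong (j +_) (sym (length-window j k)))

    occ : OccAtInf (x ++ p ++ u ++ q ++ x) W i
    occ = occAtInf-++ i ox
            (occAtInf-++ a (occAtInf-window a (i₁ ∸ a))
              (subst (OccAtInf (u ++ q ++ x) W) (at-end a (i₁ ∸ a) (m+[n∸m]≡n (<⇒≤ a<i₁)))
                (occAtInf-++ i₁ ou
                  (occAtInf-++ b (occAtInf-window b (i₂ ∸ b))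
                    (subst (OccAtInf x W) (at-end b (i₂ ∸ b) (m+[n∸m]≡n b≤i₂)) ox₂)))))

    reassoc : x ++ p ++ u ++ q ++ x ≡ x ++ (p ++ u ++ q) ++ x
    reassoc = solve 4 (λ x p u q → x ⊕ p ⊕ u ⊕ q ⊕ x ⊜ x ⊕ (p ⊕ u ⊕ q) ⊕ x) refl x p u q

module Paths {A : Set} (W : ℕ → A) (S : GraphWithWords A) where
  open GraphWithWords S
  open import Algebra.Solver.Monoid (++-monoid A) using (solve; _⊕_; _⊜_)

  backs : List E → List A
  backs []       = []
  backs (e ∷ es) = backIf e ++ backs es

  Fr-++ : ∀ xs ys → Fr (xs ++ ys) ≡ Fr xs ++ Fr ys
  Fr-++ []       ys = refl
  Fr-++ (x ∷ xs) ys = trans (cong (frontIf x ++_) (Fr-++ xs ys)) (sym (++-assoc (frontIf x) (Fr xs) (Fr ys)))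

  Bk-drop : ∀ i {e es y ys} → drop i (e ∷ es) ≡ y ∷ ys → Bk e es ≡ backs (take i (e ∷ es)) ++ Bk y ys
  Bk-drop zero    refl = refl
  Bk-drop (suc i) {e} {e' ∷ es} eq =
    trans (cong (backIf e ++_) (Bk-drop i eq)) (sym (++-assoc (backIf e) _ _))
  Bk-drop (suc i) {es = []} eq = ⊥-elim (drop-[]≢∷ i eq)

  Consecutive-drop : ∀ i {e es y ys} → drop i (e ∷ es) ≡ y ∷ ys → Consecutive e es → Consecutive y ys
  Consecutive-drop zero    refl c = c
  Consecutive-drop (suc i) {es = _ ∷ _} eq (_ , c) = Consecutive-drop i eq c
  Consecutive-drop (suc i) {es = []}    eq _       = ⊥-elim (drop-[]≢∷ i eq)

  lastE-drop : ∀ i {e es y ys} → drop i (e ∷ es) ≡ y ∷ ys → lastE e es ≡ lastE y ys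
  lastE-drop zero    refl = refl
  lastE-drop (suc i) {es = _ ∷ _} eq = lastE-drop i eq
  lastE-drop (suc i) {es = []}    eq = ⊥-elim (drop-[]≢∷ i eq)

  Consecutive-∷ʳ : ∀ x xs {y ys} → Consecutive x (xs ++ y ∷ ys) → Consecutive x (xs ++ [ y ])
  Consecutive-∷ʳ x []       (e , _) = e , tt
  Consecutive-∷ʳ x (z ∷ zs) (e , c) = e , Consecutive-∷ʳ z zs c

  lastE-∷ʳ : ∀ x xs y → lastE x (xs ++ [ y ]) ≡ y
  lastE-∷ʳ x []       y = refl
  lastE-∷ʳ x (z ∷ zs) y = lastE-∷ʳ z zs y

  backs-take-suc : ∀ (xs : List E) i {y ys} → drop i xs ≡ y ∷ ys →
                   backs (take (suc i) xs) ≡ backs (take i xs) ++ backIf y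
  backs-take-suc (x ∷ xs) zero    refl = ++-identityʳ (backIf x)
  backs-take-suc (x ∷ xs) (suc i) eq   =
    trans (cong (backIf x ++_) (backs-take-suc xs i eq)) (sym (++-assoc (backIf x) _ _))
  backs-take-suc []       i       eq   = ⊥-elim (drop-[]≢∷ i eq)

  length-backs-take-mono : ∀ (xs : List E) {i j} → i ≤ j → length (backs (take i xs)) ≤ length (backs (take j xs))
  length-backs-take-mono xs       {zero}          _         = z≤n
  length-backs-take-mono []       {suc i} {suc j} _         = z≤n
  length-backs-take-mono (x ∷ xs) {suc i} {suc j} (s≤s i≤j) =
    subst₂ _≤_ (sym (length-++ (backIf x))) (sym (length-++ (backIf x)))
      (+-monoʳ-≤ (length (backIf x)) (length-backs-take-mono xs i≤j))

  coll→dist-edge : ∀ e es → Consecutive e es → kind (src e) ≡ coll → kind (tgt (lastE e es)) ≡ dist →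
                   ∃[ t ] (kind (src t) ≡ coll × kind (tgt t) ≡ dist)
  coll→dist-edge e es c e-coll end-dist with kind (tgt e) in eq
  ... | dist = e , e-coll , eq
  coll→dist-edge e []        _            _ end-dist | coll = case trans (sym eq) end-dist of λ ()
  coll→dist-edge e (e' ∷ es) (e→e' , c)  _ end-dist | coll =
    coll→dist-edge e' es c (trans (cong kind (sym e→e')) eq) end-dist

  backIf-coll : ∀ y → kind (tgt y) ≡ coll → backIf y ≡ Bw y
  backIf-coll y y-coll with kind (tgt y)
  ... | coll = refl
  ... | dist = case y-coll of λ ()

  -- A collecting vertex has two distinct incoming edges, and y differs from one of them.
  Bw-nonempty : Prop2 W S → ∀ y → kind (tgt y) ≡ coll → 0 < length (Bw y)
  Bw-nonempty p2 y y-coll with Bw y in Bw≡ | coll-ok (tgt y) y-coll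
  ... | _ ∷ _ | _ = s≤s z≤n
  ... | []    | (e₁ , e₂ , e₁≢e₂ , t₁ , t₂) , _ =
    ⊥-elim (is e₁ t₁ λ y≡e₁ → is e₂ t₂ λ y≡e₂ → e₁≢e₂ (trans (sym y≡e₁) y≡e₂))
    where
    is : ∀ e → tgt e ≡ tgt y → ¬ ¬ (y ≡ e)
    is e e→ y≢e with _ , _ , x , _ , Bw≡x∷ʳa , _ ← proj₂ p2 y e y≢e (sym e→) y-coll =
      case ++-conicalʳ x _ (trans (sym Bw≡x∷ʳa) Bw≡) of λ ()

  module Alignment (p2 : Prop2 W S) (p3 : Prop3 W S) (p4 : Prop4 W S)
                   {e₀ es c} (s-sym : Symmetric (path e₀ es c))
                   (t : E) (t-coll : kind (src t) ≡ coll) (t-dist : kind (tgt t) ≡ dist) where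

    s : Path
    s = path e₀ es c

    L : List E
    L = e₀ ∷ es

    -- By (3), the front word of the i-th edge of s starts at this position of F(s)
    -- whenever that edge leaves a collecting vertex (Fp-drop).
    offset : ℕ → ℕ
    offset i = length (backs (take i L))

    Fp-drop : ∀ i {y ys} → drop i L ≡ y ∷ ys → kind (src y) ≡ coll →
              Fp s ≡ backs (take i L) ++ Fw y ++ Fr ys
    Fp-drop i {y} {ys} eq y-coll = begin
      Fp s                          ≡⟨ p3 s s-sym ⟩
      Bk e₀ es                      ≡⟨ Bk-drop i eq ⟩
      backs (take i L) ++ Bk y ys   ≡⟨ cong (backs (take i L) ++_) (p3 suffix (y-coll , ends-dist)) ⟨
      backs (take i L) ++ Fw y ++ Fr ys ∎
      where
      open ≡-Reasoning
      suffix : Path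
      suffix = path y ys (Consecutive-drop i eq c)
      ends-dist : kind (tgt (lastE y ys)) ≡ dist
      ends-dist = trans (cong (kind ∘ tgt) (sym (lastE-drop i eq))) (proj₂ s-sym)

    offset-< : ∀ {i j} → i < j → L [ j ]= t → offset i < offset j
    offset-< {i} {suc j} (s≤s i≤j) t-at-j with y , ys , eq ← []=-pred t-at-j = begin-strict
      offset i                              ≤⟨ length-backs-take-mono L i≤j ⟩
      offset j                              <⟨ m<m+n (offset j) back-nonempty ⟩
      offset j + length (backIf y)          ≡⟨ length-++ (backs (take j L)) ⟨
      length (backs (take j L) ++ backIf y) ≡⟨ cong length (backs-take-suc L j eq) ⟨
      offset (suc j)                        ∎
      where
      open Data.Nat.Properties.≤-Reasoning
      y-coll : kind (tgt y) ≡ coll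
      y-coll = trans (cong kind (proj₁ (Consecutive-drop j eq c))) t-coll
      back-nonempty : 0 < length (backIf y)
      back-nonempty = subst (λ w → 0 < length w) (sym (backIf-coll y y-coll)) (Bw-nonempty p2 y y-coll)

    offset-injective : ∀ {i j} → L [ i ]= t → L [ j ]= t → offset i ≡ offset j → i ≡ j
    offset-injective {i} {j} t-at-i t-at-j eq with <-cmp i j
    ... | tri< i<j _ _ = contradiction eq (<⇒≢ (offset-< i<j t-at-j))
    ... | tri≈ _ i≡j _ = i≡j
    ... | tri> _ _ j<i = contradiction (sym eq) (<⇒≢ (offset-< j<i t-at-i))

    offset-<⁻ : ∀ {i j} → offset i < offset j → i < j
    offset-<⁻ {i} {j} lt with i <? j
    ... | yes i<j = i<j
    ... | no  i≮j = contradiction lt (≤⇒≯ (length-backs-take-mono L (≮⇒≥ i≮j)))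

    occAt-offset : ∀ {i} → L [ i ]= t → OccAt (Fw t) (Fp s) (offset i)
    occAt-offset {i} t-at-i =
      subst (λ w → OccAt (Fw t) w (offset i)) (sym (Fp-drop i ([]=⇒drop t-at-i) t-coll))
        (occAt-middle (backs (take i L)) (Fw t) (Fr (drop (suc i) L)))

    AlignedEdge : ℕ → ℕ → List E → Set
    AlignedEdge P i []      = ⊥
    AlignedEdge P i (y ∷ _) =
      kind (src y) ≡ coll × kind (tgt y) ≡ dist × length (Fw y) ≡ length (Fw t) × offset i ≡ P

    alignedEdge? : ∀ P i ys → Dec (AlignedEdge P i ys)
    alignedEdge? P i []      = no λ ()
    alignedEdge? P i (y ∷ _) =
      (kind (src y) ≟ᴷ coll) ×-dec (kind (tgt y) ≟ᴷ dist)
        ×-dec (length (Fw y) ≟ length (Fw t)) ×-dec (offset i ≟ P)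
      where
      _≟ᴷ_ : ∀ (a b : Kind) → Dec (a ≡ b)
      dist ≟ᴷ dist = yes refl
      coll ≟ᴷ coll = yes refl
      dist ≟ᴷ coll = no λ ()
      coll ≟ᴷ dist = no λ ()

    record AlignedAt (P : ℕ) : Set where
      field
        index    : ℕ
        edge     : E
        rest     : List E
        at-index : drop index L ≡ edge ∷ rest
        src-coll : kind (src edge) ≡ coll
        tgt-dist : kind (tgt edge) ≡ dist
        width    : length (Fw edge) ≡ length (Fw t)
        at-P     : offset index ≡ P

    alignedAt : ∀ {P} i → AlignedEdge P i (drop i L) → AlignedAt P
    alignedAt i a with drop i L in eq
    ... | y ∷ ys = record { index = i ; edge = y ; rest = ys ; at-index = eq
                          ; src-coll = proj₁ a ; tgt-dist = proj₁ (proj₂ a)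
                          ; width = proj₁ (proj₂ (proj₂ a)) ; at-P = proj₂ (proj₂ (proj₂ a)) }

    -- If X = Fw t occurred at an unaligned position, F(s) would contain one more occurrence
    -- of X than s contains occurrences of t, against property (4) for the one-edge path t.
    unaligned-impossible : ∀ {P} → OccAt (Fw t) (Fp s) P →
                           ¬ (∃[ i ] (i < length L × AlignedEdge P i (drop i L))) → ⊥
    unaligned-impossible {P} occ unaligned = ¬¬-decide-all (_≡ t) L counting
      where
      counting : ¬ All (λ e → Dec (e ≡ t)) L
      counting dec = 1+n≰n (subst (_≤ length t-indices) (cong suc (length-map offset t-indices)) bound)
        where
        t-indices : List ℕ
        t-indices = filter ([]=? dec) (upTo (length L))

        ∈⇒t-at : ∀ {i} → i ∈ t-indices → L [ i ]= t
        ∈⇒t-at = proj₂ ∘ ∈-filter⁻ ([]=? dec)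

        P∉ : ∀ {i} → i ∈ t-indices → P ≢ offset i
        P∉ {i} i∈ P≡ = unaligned (i , []=⇒< t-at , subst (AlignedEdge P i) (sym ([]=⇒drop t-at)) aligned)
          where
          t-at : L [ i ]= t
          t-at = ∈⇒t-at i∈
          aligned : AlignedEdge P i (t ∷ drop (suc i) L)
          aligned = t-coll , t-dist , refl , sym P≡

        ps : List ℕ
        ps = P ∷ map offset t-indices

        ps-unique : Unique ps
        ps-unique = All.map⁺ (All.tabulate P∉)
                  ∷ map⁺-injectiveOn (λ i∈ j∈ → offset-injective (∈⇒t-at i∈) (∈⇒t-at j∈))
                                     (Unique.filter⁺ ([]=? dec) (Unique.upTo⁺ (length L)))

        ps-occ : All (OccAt (Fw t) (Fp s)) ps
        ps-occ = occ ∷ All.map⁺ (All.tabulate (occAt-offset ∘ ∈⇒t-at))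

        t-path : Path
        t-path = path t [] tt

        X⊑ : Fp t-path ⊑[ length ps ] Fp s
        X⊑ = subst (λ X → X ⊑[ length ps ] Fp s) (sym (++-identityʳ (Fw t))) (⊑[]-unique ps ps-unique ps-occ)

        t-at⇒∈ : ∀ {i} → L [ i ]= t → i ∈ t-indices
        t-at⇒∈ t-at = ∈-filter⁺ ([]=? dec) (∈-upTo⁺ ([]=⇒< t-at)) t-at

        bound : length ps ≤ length t-indices
        bound = ⊑[]-≤ t-indices (p4 t-path s (length ps) (t-coll , t-dist) s-sym X⊑)
                  λ {i} → t-at⇒∈ ∘ occAt-[]⇒[]= L i

    occurrence-aligned : ∀ {P} → OccAt (Fw t) (Fp s) P → AlignedAt P
    occurrence-aligned {P} occ with anyUpTo? (λ i → alignedEdge? P i (drop i L)) (length L)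
    ... | yes (i , _ , a) = alignedAt i a
    ... | no  unaligned   = ⊥-elim (unaligned-impossible occ unaligned)

    aligned-suffix : ∀ α {w} (a : AlignedAt (length α)) → Fp s ≡ α ++ w →
                     Fw (AlignedAt.edge a) ++ Fr (AlignedAt.rest a) ≡ w
    aligned-suffix α a eq = proj₂ (++-cancel-length (backs (take index L)) α at-P
                                       (trans (sym (Fp-drop index at-index src-coll)) eq))
      where open AlignedAt a

    segment : ∀ {P P'} (a : AlignedAt P) (a' : AlignedAt P') → P < P' →
              ∃[ s' ] (Symmetric s' × Fp s' ++ Fr (AlignedAt.rest a') ≡ Fw (AlignedAt.edge a) ++ Fr (AlignedAt.rest a))
    segment a a' P<P' = path y (mid ++ [ y' ]) c' , (src-coll a , end-dist) , Fp-segment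
      where
      open AlignedAt
      y y' : E
      y  = edge a
      y' = edge a'

      infix′ : ∃[ mid ] rest a ≡ mid ++ y' ∷ rest a'
      infix′ = drop-<⇒infix L {index a} {index a'}
                 (offset-<⁻ (subst₂ _<_ (sym (at-P a)) (sym (at-P a')) P<P')) (at-index a) (at-index a')

      mid : List E
      mid = proj₁ infix′

      c' : Consecutive y (mid ++ [ y' ])
      c' = Consecutive-∷ʳ y mid {y'} (subst (Consecutive y) (proj₂ infix′) (Consecutive-drop (index a) (at-index a) c))

      end-dist : kind (tgt (lastE y (mid ++ [ y' ]))) ≡ dist
      end-dist = trans (cong (kind ∘ tgt) (lastE-∷ʳ y mid y')) (tgt-dist a')

      Fp-segment : (Fw y ++ Fr (mid ++ [ y' ])) ++ Fr (rest a') ≡ Fw y ++ Fr (rest a)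
      Fp-segment = begin
        (Fw y ++ Fr (mid ++ [ y' ])) ++ Fr (rest a') ≡⟨ ++-assoc (Fw y) _ _ ⟩
        Fw y ++ Fr (mid ++ [ y' ]) ++ Fr (rest a')   ≡⟨ cong (Fw y ++_) (Fr-++ (mid ++ [ y' ]) (rest a')) ⟨
        Fw y ++ Fr ((mid ++ [ y' ]) ++ rest a')      ≡⟨ cong (λ z → Fw y ++ Fr z) (++-assoc mid [ y' ] (rest a')) ⟩
        Fw y ++ Fr (mid ++ y' ∷ rest a')             ≡⟨ cong (λ z → Fw y ++ Fr z) (proj₂ infix′) ⟨
        Fw y ++ Fr (rest a)                          ∎
        where open ≡-Reasoning

    sandwich-subpath : ∀ {g} → 0 < length g → (Fw t ++ g ++ Fw t) ⊑ Fp s →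
                       ∃[ s' ] (Symmetric s' × Fp s' ≡ Fw t ++ g ++ Fw t)
    sandwich-subpath {g} 0<|g| (α , β , eq) =
      let s' , s'-sym , Fp-s' = segment a a' |α|< in
      s' , s'-sym , ++-cancelʳ β _ _ (begin
        Fp s' ++ β                 ≡⟨ cong (Fp s' ++_) Fr-rest'≡β ⟨
        Fp s' ++ Fr (rest a')      ≡⟨ Fp-s' ⟩
        Fw (edge a) ++ Fr (rest a) ≡⟨ aligned-suffix α a eq₁ ⟩
        X ++ (g ++ X) ++ β         ≡⟨ solve 3 (λ x g b → x ⊕ (g ⊕ x) ⊕ b ⊜ (x ⊕ g ⊕ x) ⊕ b) refl X g β ⟩
        (X ++ g ++ X) ++ β         ∎)
      where
      open AlignedAt
      open ≡-Reasoning
      X : List A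
      X = Fw t

      eq₁ : Fp s ≡ α ++ X ++ (g ++ X) ++ β
      eq₁ = trans (sym eq) (solve 4 (λ a x g b → a ⊕ (x ⊕ g ⊕ x) ⊕ b ⊜ a ⊕ x ⊕ (g ⊕ x) ⊕ b) refl α X g β)

      eq₂ : Fp s ≡ (α ++ X ++ g) ++ X ++ β
      eq₂ = trans (sym eq) (solve 4 (λ a x g b → a ⊕ (x ⊕ g ⊕ x) ⊕ b ⊜ (a ⊕ x ⊕ g) ⊕ x ⊕ b) refl α X g β)

      a : AlignedAt (length α)
      a = occurrence-aligned (subst (λ w → OccAt X w (length α)) (sym eq₁) (occAt-middle α X ((g ++ X) ++ β)))

      a' : AlignedAt (length (α ++ X ++ g))
      a' = occurrence-aligned
             (subst (λ w → OccAt X w (length (α ++ X ++ g))) (sym eq₂) (occAt-middle (α ++ X ++ g) X β))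

      |α|< : length α < length (α ++ X ++ g)
      |α|< = subst (length α <_) (sym (length-++ α))
               (m<m+n _ (subst (0 <_) (sym (length-++ X)) (≤-trans 0<|g| (m≤n+m _ _))))

      Fr-rest'≡β : Fr (rest a') ≡ β
      Fr-rest'≡β = proj₂ (++-cancel-length (Fw (edge a')) X (width a') (aligned-suffix (α ++ X ++ g) a' eq₂))

lemma3 : {A : Set} (W : ℕ → A) (S : GraphWithWords A) →
         Recurrent W → RauzyScheme W S →
         ∀ (u : List A) → u ⊑∞ W →
         ∃[ s ] (Admissible W S s × u ⊑ GraphWithWords.Fp S s)
lemma3 W S rec (_ , p2 , p3 , p4 , p5 , p6) u u⊑W =
  let open GraphWithWords S
      path e es c , (e-coll , end-dist) , _ = p6 u u⊑W
      t , t-coll , t-dist = Paths.coll→dist-edge W S e es c e-coll end-dist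
      g , 0<|g| , u⊑g , v⊑W = recurrent-sandwich W rec (proj₁ (p5 t)) u⊑W
      path e' es' c' , s-sym , v⊑Fs = p6 _ v⊑W
      s' , s'-sym , Fs'≡v =
        Paths.Alignment.sandwich-subpath W S p2 p3 p4 {e'} {es'} {c'} s-sym t t-coll t-dist 0<|g| v⊑Fs
  in s' , (s'-sym , subst (_⊑∞ W) (sym Fs'≡v) v⊑W)
        , subst (u ⊑_) (sym Fs'≡v) (⊑-++-both (Fw t) (Fw t) u⊑g)
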